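{- Let $s$ be a non-empty string over $\Sigma$ with run-length encoding $s = a_1^{m_1}\cdots a_r^{m_r}$, let $h = \lceil r/2 \rceil$, and let $\mathcal{K}(s)$ be the peeling kernel of $s$. Then $\mathcal{K}(s) = a_h^{m_h}$ if $r$ is odd, and $\mathcal{K}(s) = a_h^{m_h} \cdot a_{h+1}^{m_{h+1}}$ if $r$ is even. In either case $\mathcal{K}(s)$ contains at most two distinct symbols.
   Context: Let $\Sigma$ be an alphabet and let $\texttt{@}$ and $\texttt{\$}$ be two distinct symbols not in $\Sigma$. The run-length encoding of a non-empty string $s$ is the unique decomposition $s = a_1^{m_1}\cdots a_r^{m_r}$ with $a_i\in\Sigma$, $m_i \ge 1$, $a_i \ne a_{i+1}$. For $s\in\Sigma^*$ let $\hat{s} = \texttt{@}\,s\,\texttt{\$}$. The leading (resp. trailing) run of a non-empty string is its longest prefix (resp. suffix) consisting of a single repeated symbol. The Flashback decomposition $\mathcal{F}(s) = [(\sigma_0,p_0),\ldots,(\sigma_{k-1},p_{k-1})]$ is produced starting with active span $\hat{s}$: (i) if the span is empty, stop; (ii) let $\ell$ be its leading run length; if $\ell$ equals the span length, append (span, $0$) and stop; (iii) otherwise let $\sigma$ be the leading run followed by the trailing run and the middle the span with both removed; if the middle is empty append $(\sigma,0)$ and stop, else append $(\sigma,\ell)$ and continue on the middle. The peeling kernel is $\mathcal{K}(s) = \sigma_{k-1}$, the symbol string of the last (terminal) token. -}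

module Defs where

open import Data.Nat using (ℕ; zero; suc; _+_; _∸_; _≤_; _≟_)
open import Data.Nat.Base using (⌈_/2⌉; _%_)
open import Data.Bool using (Bool; true; false; if_then_else_)
open import Data.List using (List; []; _∷_; _++_; length; reverse; replicate; take; drop; last; map)
open import Data.List.Relation.Unary.All using (All)
open import Data.List.Relation.Unary.Linked using (Linked)
open import Data.Maybe using (Maybe; just; nothing)
open import Data.Product using (_×_; _,_; proj₁; proj₂; Σ; ∃₂)
open import Data.Sum using (_⊎_)
open import Relation.Binary.Definitions using (DecidableEquality)
open import Relation.Binary.PropositionalEquality using (_≡_; _≢_; refl; cong)
open import Relation.Nullary using (yes; no; Dec; does)

data Ext (A : Set) : Set where
  at     : Ext A
  dollar : Ext A
  sym    : A → Ext A

module _ {A : Set} (_≟A_ : DecidableEquality A) where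

  _≟E_ : DecidableEquality (Ext A)
  at ≟E at = yes refl
  at ≟E dollar = no (λ ())
  at ≟E sym _ = no (λ ())
  dollar ≟E at = no (λ ())
  dollar ≟E dollar = yes refl
  dollar ≟E sym _ = no (λ ())
  sym _ ≟E at = no (λ ())
  sym _ ≟E dollar = no (λ ())
  sym a ≟E sym b with a ≟A b
  ... | yes refl = yes refl
  ... | no a≢b = no (λ { refl → a≢b refl })

  takeEq : Ext A → List (Ext A) → List (Ext A)
  takeEq c [] = []
  takeEq c (x ∷ xs) = if does (x ≟E c) then x ∷ takeEq c xs else []

  leadRun : List (Ext A) → List (Ext A)
  leadRun [] = []
  leadRun (x ∷ xs) = x ∷ takeEq x xs

  trailRun : List (Ext A) → List (Ext A)
  trailRun xs = reverse (leadRun (reverse xs))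

  -- Flashback decomposition driven by a fuel argument (each non-terminal step
  -- strictly shortens the active span, so fuel = length of the span suffices)
  flashFuel : ℕ → List (Ext A) → List (List (Ext A) × ℕ)
  flashFuel zero _ = []
  flashFuel (suc f) [] = []
  flashFuel (suc f) span@(_ ∷ _) with length (leadRun span) ≟ length span
  ... | yes _ = (span , 0) ∷ []
  ... | no _ with leadRun span | trailRun span
  ...   | ld | tr with take (length span ∸ length ld ∸ length tr) (drop (length ld) span)
  ...     | [] = (ld ++ tr , 0) ∷ []
  ...     | mid@(_ ∷ _) = (ld ++ tr , length ld) ∷ flashFuel f mid

  hat : List A → List (Ext A)
  hat s = at ∷ (map sym s ++ dollar ∷ [])

  flashback : List A → List (List (Ext A) × ℕ)
  flashback s = flashFuel (length (hat s)) (hat s)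

  kernel : List A → Maybe (List (Ext A))
  kernel s with last (flashback s)
  ... | just (σ , _) = just σ
  ... | nothing = nothing

expand : {A : Set} → List (A × ℕ) → List A
expand [] = []
expand ((a , m) ∷ rs) = replicate m a ++ expand rs

IsRLE : {A : Set} → List (A × ℕ) → Set
IsRLE rs = All (λ p → 1 ≤ proj₂ p) rs × Linked (λ p q → proj₁ p ≢ proj₁ q) rs

-- block rs i = a_i^{m_i} (1-based index i; empty if i is out of range)
block : {A : Set} → List (A × ℕ) → ℕ → List A
block [] _ = []
block (_ ∷ _) zero = []
block ((a , m) ∷ _) (suc zero) = replicate m a
block (_ ∷ rs) (suc (suc i)) = block rs (suc i)

AtMostTwoSymbols : {B : Set} → List B → Set
AtMostTwoSymbols {B} w = ∃₂ λ (x y : B) → All (λ c → c ≡ x ⊎ c ≡ y) w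

{-# OPTIONS --safe #-}
module Submission where

-- Each non-terminal step of the Flashback decomposition strips the first and the last run of
-- the active span and continues on the runs in between; when one or two runs are left, they
-- form the terminal token. Hence the kernel consists of the middle run (odd number of runs) or
-- the two middle runs (even number) of ŝ. Since @ and $ contribute one run each, ŝ has r + 2
-- runs and its middle runs are those of s: run h + 1 of ŝ is run h of s.

open import Defs
open import Data.Nat using (ℕ; zero; suc; _+_; _%_; ⌈_/2⌉; _∸_; _≤_; z≤n; s≤s; s≤s⁻¹; _≟_)
open import Data.Nat.Properties using (⌈n/2⌉≤n; m≤n⇒m≤1+n; ≤-refl; ≤-trans; m+1+n≢m; m+n∸m≡n; m+n∸n≡m)
open import Data.List using (List; []; _∷_; _++_; _∷ʳ_; [_]; length; map; replicate; reverse; reverseAcc; take; drop; last; initLast; _∷ʳ′_)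
open import Data.List.Properties using (++-identityʳ; ++-assoc; length-++; length-++-sucʳ; length-++-≤ˡ; length-++-≤ʳ; map-++; map-replicate; reverse-++; unfold-reverse)
open import Data.List.Relation.Unary.All as All using (All; []; _∷_)
import Data.List.Relation.Unary.All.Properties as All
import Data.List.Relation.Unary.Any.Properties as Any
open import Data.List.Relation.Unary.Linked as Linked using (Linked; []; [-]; _∷_)
open import Data.Maybe using (just)
open import Data.Maybe.Properties using (just-injective)
open import Data.Product using (_×_; _,_; proj₁; proj₂; ∃; map₁; map₂)
open import Data.Sum using (inj₁; inj₂)
open import Data.Empty using (⊥-elim)
open import Function using (_∘_)
open import Relation.Binary.Core using (Rel)
open import Relation.Binary.Definitions using (DecidableEquality; Symmetric)
open import Relation.Binary.PropositionalEquality using (_≡_; _≢_; refl; trans; cong; cong₂; subst; ≢-sym; module ≡-Reasoning) renaming (sym to ≡-sym)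
open import Relation.Nullary using (yes; no)

open ≡-Reasoning

even⇒1+⌈n/2⌉≤n : ∀ n → suc n % 2 ≡ 0 → suc ⌈ suc n /2⌉ ≤ suc n
even⇒1+⌈n/2⌉≤n (suc zero)    _    = ≤-refl
even⇒1+⌈n/2⌉≤n (suc (suc n)) even = s≤s (m≤n⇒m≤1+n (even⇒1+⌈n/2⌉≤n n even))

module _ {C : Set} where

  length-++-++-∸ : ∀ (xs ys zs : List C) → length (xs ++ ys ++ zs) ∸ length xs ∸ length zs ≡ length ys
  length-++-++-∸ xs ys zs rewrite length-++ xs {ys ++ zs} | length-++ ys {zs} =
    trans (cong (_∸ length zs) (m+n∸m≡n (length xs) _)) (m+n∸n≡m (length ys) (length zs))

  length≢length-++-++-∷ : ∀ (xs ys : List C) z zs → length xs ≢ length (xs ++ ys ++ z ∷ zs)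
  length≢length-++-++-∷ xs ys z zs eq = m+1+n≢m (length xs) (≡-sym (begin
    length xs                          ≡⟨ eq ⟩
    length (xs ++ ys ++ z ∷ zs)        ≡⟨ length-++ xs ⟩
    length xs + length (ys ++ z ∷ zs)  ≡⟨ cong (length xs +_) (length-++-sucʳ ys z zs) ⟩
    length xs + suc (length (ys ++ zs)) ∎))

  replicate-∷ʳ : ∀ n (x : C) → replicate n x ∷ʳ x ≡ x ∷ replicate n x
  replicate-∷ʳ zero    x = refl
  replicate-∷ʳ (suc n) x = cong (x ∷_) (replicate-∷ʳ n x)

  reverse-replicate : ∀ n (x : C) → reverse (replicate n x) ≡ replicate n x
  reverse-replicate zero    x = refl
  reverse-replicate (suc n) x = begin
    reverse (x ∷ replicate n x)   ≡⟨ unfold-reverse x (replicate n x) ⟩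
    reverse (replicate n x) ∷ʳ x  ≡⟨ cong (_∷ʳ x) (reverse-replicate n x) ⟩
    replicate n x ∷ʳ x            ≡⟨ replicate-∷ʳ n x ⟩
    x ∷ replicate n x             ∎

  length-∷ʳ : ∀ (x : C) xs → length (xs ∷ʳ x) ≡ suc (length xs)
  length-∷ʳ x []       = refl
  length-∷ʳ x (_ ∷ xs) = cong suc (length-∷ʳ x xs)

  drop-length-++ : ∀ (xs ys : List C) → drop (length xs) (xs ++ ys) ≡ ys
  drop-length-++ []       ys = refl
  drop-length-++ (_ ∷ xs) ys = drop-length-++ xs ys

  take-length-++ : ∀ (xs ys : List C) → take (length xs) (xs ++ ys) ≡ xs
  take-length-++ []       ys = refl
  take-length-++ (x ∷ xs) ys = cong (x ∷_) (take-length-++ xs ys)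

  module _ {ℓ} {R : Rel C ℓ} where

    Linked-++⁻ˡ : ∀ xs {ys} → Linked R (xs ++ ys) → Linked R xs
    Linked-++⁻ˡ []           _         = []
    Linked-++⁻ˡ (x ∷ [])     _         = [-]
    Linked-++⁻ˡ (x ∷ y ∷ xs) (r ∷ rxs) = r ∷ Linked-++⁻ˡ (y ∷ xs) rxs

    Linked-reverseAcc : Symmetric R → ∀ {x} xs ys →
      Linked R (x ∷ xs) → Linked R (x ∷ ys) → Linked R (reverseAcc (x ∷ ys) xs)
    Linked-reverseAcc R-sym []       ys _          rys = rys
    Linked-reverseAcc R-sym (z ∷ xs) ys (r ∷ rzxs) rys = Linked-reverseAcc R-sym xs (_ ∷ ys) rzxs (R-sym r ∷ rys)

    Linked-reverse : Symmetric R → ∀ {xs} → Linked R xs → Linked R (reverse xs)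
    Linked-reverse R-sym {[]}     _   = []
    Linked-reverse R-sym {x ∷ xs} rxs = Linked-reverseAcc R-sym xs [] rxs [-]

  All-reverse : ∀ {P : C → Set} {xs} → All P xs → All P (reverse xs)
  All-reverse pxs = All.tabulate (All.lookup pxs ∘ Any.reverse⁻)

module _ {B : Set} where

  run : B × ℕ → List B
  run (a , m) = replicate m a

  expand-++ : ∀ (L N : List (B × ℕ)) → expand (L ++ N) ≡ expand L ++ expand N
  expand-++ []      N = refl
  expand-++ (r ∷ L) N = begin
    run r ++ expand (L ++ N)         ≡⟨ cong (run r ++_) (expand-++ L N) ⟩
    run r ++ (expand L ++ expand N)  ≡⟨ ≡-sym (++-assoc (run r) (expand L) (expand N)) ⟩
    (run r ++ expand L) ++ expand N  ∎

  expand-∷ʳ : ∀ (L : List (B × ℕ)) r → expand (L ∷ʳ r) ≡ expand L ++ run r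
  expand-∷ʳ L r = trans (expand-++ L [ r ]) (cong (expand L ++_) (++-identityʳ (run r)))

  expand-reverse : ∀ (L : List (B × ℕ)) → expand (reverse L) ≡ reverse (expand L)
  expand-reverse []      = refl
  expand-reverse (r ∷ L) = begin
    expand (reverse (r ∷ L))
      ≡⟨ cong expand (unfold-reverse r L) ⟩
    expand (reverse L ∷ʳ r)
      ≡⟨ expand-∷ʳ (reverse L) r ⟩
    expand (reverse L) ++ run r
      ≡⟨ cong₂ _++_ (expand-reverse L) (≡-sym (reverse-replicate (proj₂ r) (proj₁ r))) ⟩
    reverse (expand L) ++ reverse (run r)
      ≡⟨ ≡-sym (reverse-++ (run r) (expand L)) ⟩
    reverse (run r ++ expand L) ∎

  IsRLE-reverse : ∀ {L : List (B × ℕ)} → IsRLE L → IsRLE (reverse L)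
  IsRLE-reverse (pos , lk) = All-reverse pos , Linked-reverse ≢-sym lk

  IsRLE-inner : ∀ {r s} (M : List (B × ℕ)) → IsRLE (r ∷ M ∷ʳ s) → IsRLE M
  IsRLE-inner M (pos , lk) = proj₁ (All.∷ʳ⁻ (All.tail pos)) , Linked-++⁻ˡ M (Linked.tail lk)

  length-expand-inner : ∀ r (M : List (B × ℕ)) s → length (expand M) ≤ length (expand (r ∷ M ∷ʳ s))
  length-expand-inner r M s = ≤-trans
    (subst (length (expand M) ≤_) (cong length (≡-sym (expand-∷ʳ M s))) (length-++-≤ˡ (expand M)))
    (length-++-≤ʳ (expand (M ∷ʳ s)) {run r})

  block-++ˡ : ∀ (L N : List (B × ℕ)) i → suc i ≤ length L → block (L ++ N) (suc i) ≡ block L (suc i)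
  block-++ˡ (r ∷ L) N zero    _        = refl
  block-++ˡ (r ∷ L) N (suc i) (s≤s i<) = block-++ˡ L N i i<

  data Centre : List (B × ℕ) → List B → Set where
    one  : ∀ r → Centre (r ∷ []) (run r)
    two  : ∀ r s → Centre (r ∷ s ∷ []) (run r ++ run s)
    peel : ∀ {M K} r s → Centre M K → Centre (r ∷ M ∷ʳ s) K

  centre-exists : ∀ n r (L : List (B × ℕ)) → length L ≤ n → ∃ (Centre (r ∷ L))
  centre-exists n r L L≤n with initLast L
  centre-exists n       r .[]              _         | []              = run r , one r
  centre-exists n       r .([] ∷ʳ s)       _         | [] ∷ʳ′ s        = run r ++ run s , two r s
  centre-exists (suc n) r .((m ∷ M) ∷ʳ s) (s≤s L≤n) | (m ∷ M) ∷ʳ′ s =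
    map₂ (peel r s) (centre-exists n m M (≤-trans (length-++-≤ˡ M) L≤n))

  centre-odd : ∀ {L : List (B × ℕ)} {K} → Centre L K → length L % 2 ≡ 1 → K ≡ block L ⌈ length L /2⌉
  centre-odd (one r) _ = refl
  centre-odd (peel {[]} r s ())
  -- Once the length is suc (suc (length M)), both _% 2 and ⌈_/2⌉ reduce by definition,
  -- and the middle indices of r ∷ M ∷ʳ s are those of M shifted by one.
  centre-odd (peel {m ∷ M} r s c) odd rewrite length-∷ʳ s M =
    trans (centre-odd c odd) (≡-sym (block-++ˡ (m ∷ M) [ s ] _ (⌈n/2⌉≤n (suc (length M)))))

  centre-even : ∀ {L : List (B × ℕ)} {K} → Centre L K → length L % 2 ≡ 0 →
    K ≡ block L ⌈ length L /2⌉ ++ block L (suc ⌈ length L /2⌉)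
  centre-even (two r s) _ = refl
  centre-even (peel {[]} r s ())
  centre-even (peel {m ∷ M} r s c) even rewrite length-∷ʳ s M =
    trans (centre-even c even) (≡-sym (cong₂ _++_
      (block-++ˡ (m ∷ M) [ s ] _ (⌈n/2⌉≤n (suc (length M))))
      (block-++ˡ (m ∷ M) [ s ] _ (even⇒1+⌈n/2⌉≤n (length M) even))))

  Centre-atMostTwoSymbols : ∀ {L : List (B × ℕ)} {K} → Centre L K → AtMostTwoSymbols K
  Centre-atMostTwoSymbols (one (a , m))         = a , a , All.replicate⁺ m (inj₁ refl)
  Centre-atMostTwoSymbols (two (a , m) (b , n)) =
    a , b , All.++⁺ (All.replicate⁺ m (inj₁ refl)) (All.replicate⁺ n (inj₂ refl))
  Centre-atMostTwoSymbols (peel r s c)          = Centre-atMostTwoSymbols c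

module _ {B C : Set} (f : B → C) where

  run-map : ∀ (r : B × ℕ) → run (map₁ f r) ≡ map f (run r)
  run-map (a , m) = ≡-sym (map-replicate f m a)

  expand-map : ∀ (L : List (B × ℕ)) → expand (map (map₁ f) L) ≡ map f (expand L)
  expand-map []      = refl
  expand-map (r ∷ L) = trans (cong₂ _++_ (run-map r) (expand-map L)) (≡-sym (map-++ f (run r) (expand L)))

  Centre-map : ∀ {L K} → Centre L K → Centre (map (map₁ f) L) (map f K)
  Centre-map (one r)   = subst (Centre _) (run-map r) (one _)
  Centre-map (two r s) =
    subst (Centre _) (trans (cong₂ _++_ (run-map r) (run-map s)) (≡-sym (map-++ f (run r) (run s)))) (two _ _)
  Centre-map (peel {M} {K} r s c) =
    subst (λ L → Centre L (map f K)) (cong (map₁ f r ∷_) (≡-sym (map-++ (map₁ f) M [ s ]))) (peel _ _ (Centre-map c))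

module Flashback {A : Set} (_≟A_ : DecidableEquality A) where

  Span : Set
  Span = List (Ext A)

  middle : Span → Span
  middle span = take (length span ∸ length (leadRun _≟A_ span) ∸ length (trailRun _≟A_ span))
                     (drop (length (leadRun _≟A_ span)) span)

  -- The result of flashFuel once a span of at least two runs has lost its leading run ld and
  -- trailing run tr, by cases on what is left in between (cf. the last clauses of flashFuel).
  peelResult : ℕ → Span → Span → Span → List (Span × ℕ)
  peelResult f ld tr []            = (ld ++ tr , 0) ∷ []
  peelResult f ld tr mid@(_ ∷ _) = (ld ++ tr , length ld) ∷ flashFuel _≟A_ f mid

  flashFuel-oneRun : ∀ f x xs → length (leadRun _≟A_ (x ∷ xs)) ≡ length (x ∷ xs) →
    flashFuel _≟A_ (suc f) (x ∷ xs) ≡ (x ∷ xs , 0) ∷ []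
  flashFuel-oneRun f x xs whole with length (leadRun _≟A_ (x ∷ xs)) ≟ length (x ∷ xs)
  ... | yes _   = refl
  ... | no part = ⊥-elim (part whole)

  flashFuel-step : ∀ f x xs {mid} → length (leadRun _≟A_ (x ∷ xs)) ≢ length (x ∷ xs) → middle (x ∷ xs) ≡ mid →
    flashFuel _≟A_ (suc f) (x ∷ xs) ≡ peelResult f (leadRun _≟A_ (x ∷ xs)) (trailRun _≟A_ (x ∷ xs)) mid
  flashFuel-step f x xs part eq with length (leadRun _≟A_ (x ∷ xs)) ≟ length (x ∷ xs)
  ... | yes whole = ⊥-elim (part whole)
  ... | no _ with middle (x ∷ xs) | eq
  ...   | []    | refl = refl
  ...   | _ ∷ _ | refl = refl

  takeEq-replicate : ∀ a k (X : Span) → takeEq _≟A_ a (replicate k a ++ X) ≡ replicate k a ++ takeEq _≟A_ a X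
  takeEq-replicate a zero    X = refl
  takeEq-replicate a (suc k) X with _≟E_ _≟A_ a a
  ... | yes _   = cong (a ∷_) (takeEq-replicate a k X)
  ... | no a≢a = ⊥-elim (a≢a refl)

  takeEq-expand : ∀ {a m} L → IsRLE ((a , m) ∷ L) → takeEq _≟A_ a (expand L) ≡ []
  takeEq-expand []                  _                          = refl
  takeEq-expand ((b , zero) ∷ L)    ((_ ∷ () ∷ _) , _)
  takeEq-expand {a} ((b , suc j) ∷ L) (_ , a≢b ∷ _) with _≟E_ _≟A_ b a
  ... | yes b≡a = ⊥-elim (a≢b (≡-sym b≡a))
  ... | no _    = refl

  leadRun-expand : ∀ {r L} → IsRLE (r ∷ L) → leadRun _≟A_ (expand (r ∷ L)) ≡ run r
  leadRun-expand {a , zero}  ((() ∷ _) , _)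
  leadRun-expand {a , suc i} {L} rle = cong (a ∷_) (begin
    takeEq _≟A_ a (replicate i a ++ expand L)   ≡⟨ takeEq-replicate a i (expand L) ⟩
    replicate i a ++ takeEq _≟A_ a (expand L)   ≡⟨ cong (replicate i a ++_) (takeEq-expand L rle) ⟩
    replicate i a ++ []                         ≡⟨ ++-identityʳ (replicate i a) ⟩
    replicate i a                               ∎)

  trailRun-expand : ∀ L {r} → IsRLE (L ∷ʳ r) → trailRun _≟A_ (expand (L ∷ʳ r)) ≡ run r
  trailRun-expand L {r} rle = begin
    reverse (leadRun _≟A_ (reverse (expand (L ∷ʳ r))))
      ≡⟨ cong (reverse ∘ leadRun _≟A_) (≡-sym (expand-reverse (L ∷ʳ r))) ⟩
    reverse (leadRun _≟A_ (expand (reverse (L ∷ʳ r))))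
      ≡⟨ cong (reverse ∘ leadRun _≟A_ ∘ expand) (reverse-++ L [ r ]) ⟩
    reverse (leadRun _≟A_ (expand (r ∷ reverse L)))
      ≡⟨ cong reverse (leadRun-expand (subst IsRLE (reverse-++ L [ r ]) (IsRLE-reverse rle))) ⟩
    reverse (run r)
      ≡⟨ reverse-replicate (proj₂ r) (proj₁ r) ⟩
    run r ∎

  middle-++ : ∀ P E Q → leadRun _≟A_ (P ++ E ++ Q) ≡ P → trailRun _≟A_ (P ++ E ++ Q) ≡ Q →
    middle (P ++ E ++ Q) ≡ E
  middle-++ P E Q lead trail = begin
    middle (P ++ E ++ Q)
      ≡⟨ cong₂ (λ ld tr → take (length span ∸ length ld ∸ length tr) (drop (length ld) span)) lead trail ⟩
    take (length (P ++ E ++ Q) ∸ length P ∸ length Q) (drop (length P) (P ++ E ++ Q))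
      ≡⟨ cong₂ take (length-++-++-∸ P E Q) (drop-length-++ P (E ++ Q)) ⟩
    take (length E) (E ++ Q)
      ≡⟨ take-length-++ E Q ⟩
    E ∎
    where span = P ++ E ++ Q

  flashFuel-split : ∀ f {c P E q Q} →
    leadRun _≟A_ (c ∷ P ++ E ++ q ∷ Q) ≡ c ∷ P → trailRun _≟A_ (c ∷ P ++ E ++ q ∷ Q) ≡ q ∷ Q →
    flashFuel _≟A_ (suc f) (c ∷ P ++ E ++ q ∷ Q) ≡ peelResult f (c ∷ P) (q ∷ Q) E
  flashFuel-split f {c} {P} {E} {q} {Q} lead trail = begin
    flashFuel _≟A_ (suc f) span
      ≡⟨ flashFuel-step f c (P ++ E ++ q ∷ Q) part (middle-++ (c ∷ P) E (q ∷ Q) lead trail) ⟩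
    peelResult f (leadRun _≟A_ span) (trailRun _≟A_ span) E
      ≡⟨ cong₂ (λ ld tr → peelResult f ld tr E) lead trail ⟩
    peelResult f (c ∷ P) (q ∷ Q) E ∎
    where
      span = c ∷ P ++ E ++ q ∷ Q
      part : length (leadRun _≟A_ span) ≢ length span
      part whole = length≢length-++-++-∷ (c ∷ P) E q Q (trans (cong length (≡-sym lead)) whole)

  flashFuel-peel : ∀ f r M s → IsRLE (r ∷ M ∷ʳ s) →
    flashFuel _≟A_ (suc f) (expand (r ∷ M ∷ʳ s)) ≡ peelResult f (run r) (run s) (expand M)
  flashFuel-peel f (a , zero) M s ((() ∷ _) , _)
  flashFuel-peel f r M (b , zero) (pos , _) with proj₂ (All.∷ʳ⁻ (All.tail pos))
  ... | ()
  flashFuel-peel f r@(a , suc i) M s@(b , suc j) rle = begin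
    flashFuel _≟A_ (suc f) (run r ++ expand (M ∷ʳ s))
      ≡⟨ cong (λ X → flashFuel _≟A_ (suc f) (run r ++ X)) (expand-∷ʳ M s) ⟩
    flashFuel _≟A_ (suc f) (run r ++ expand M ++ run s)
      ≡⟨ flashFuel-split f lead trail ⟩
    peelResult f (run r) (run s) (expand M) ∎
    where
      lead : leadRun _≟A_ (run r ++ expand M ++ run s) ≡ run r
      lead = subst (λ X → leadRun _≟A_ (run r ++ X) ≡ run r) (expand-∷ʳ M s) (leadRun-expand rle)
      trail : trailRun _≟A_ (run r ++ expand M ++ run s) ≡ run s
      trail = subst (λ X → trailRun _≟A_ (run r ++ X) ≡ run s) (expand-∷ʳ M s) (trailRun-expand (r ∷ M) rle)

  last-peelResult : ∀ f P Q E {v} → last (flashFuel _≟A_ f E) ≡ just v → last (peelResult f P Q E) ≡ just v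
  last-peelResult zero    P Q []      ()
  last-peelResult (suc f) P Q []      ()
  last-peelResult f       P Q (e ∷ E) eq with flashFuel _≟A_ f (e ∷ E)
  last-peelResult f       P Q (e ∷ E) () | []
  last-peelResult f       P Q (e ∷ E) eq | _ ∷ _ = eq

  flashFuel-centre : ∀ {L K} f → Centre L K → IsRLE L → length (expand L) ≤ f →
    last (flashFuel _≟A_ f (expand L)) ≡ just (K , 0)
  flashFuel-centre f       (one (a , zero))    ((() ∷ _) , _) _
  flashFuel-centre zero    (one (a , suc i))   _   ()
  flashFuel-centre (suc f) (one r@(a , suc i)) rle _ = begin
    last (flashFuel _≟A_ (suc f) (run r ++ []))  ≡⟨ cong last (flashFuel-oneRun f a _ whole) ⟩
    just (run r ++ [] , 0)                       ≡⟨ cong (λ K → just (K , 0)) (++-identityʳ (run r)) ⟩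
    just (run r , 0)                             ∎
    where
      whole : length (leadRun _≟A_ (run r ++ [])) ≡ length (run r ++ [])
      whole = cong length (trans (leadRun-expand rle) (≡-sym (++-identityʳ (run r))))
  flashFuel-centre f       (two (a , zero) s)  ((() ∷ _) , _) _
  flashFuel-centre zero    (two (a , suc i) s) _   ()
  flashFuel-centre (suc f) (two r s)           rle _ = cong last (flashFuel-peel f r [] s rle)
  flashFuel-centre f       (peel (a , zero) s c)  ((() ∷ _) , _) _
  flashFuel-centre zero    (peel (a , suc i) s c) _   ()
  flashFuel-centre (suc f) (peel {M} {K} r@(a , suc i) s c) rle 1+M≤1+f = begin
    last (flashFuel _≟A_ (suc f) (expand (r ∷ M ∷ʳ s)))
      ≡⟨ cong last (flashFuel-peel f r M s rle) ⟩
    last (peelResult f (run r) (run s) (expand M))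
      ≡⟨ last-peelResult f _ _ _ (flashFuel-centre f c (IsRLE-inner M rle) M≤f) ⟩
    just (K , 0) ∎
    where
      M≤f : length (expand M) ≤ f
      M≤f = ≤-trans (length-expand-inner (a , i) M s) (s≤s⁻¹ 1+M≤1+f)

  hatRuns : List (A × ℕ) → List (Ext A × ℕ)
  hatRuns runs = (at , 1) ∷ map (map₁ sym) runs ∷ʳ (dollar , 1)

  expand-hatRuns : ∀ runs → expand (hatRuns runs) ≡ hat _≟A_ (expand runs)
  expand-hatRuns runs = cong (at ∷_) (begin
    expand (map (map₁ sym) runs ∷ʳ (dollar , 1))     ≡⟨ expand-∷ʳ (map (map₁ sym) runs) (dollar , 1) ⟩
    expand (map (map₁ sym) runs) ++ dollar ∷ []      ≡⟨ cong (_++ dollar ∷ []) (expand-map sym runs) ⟩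
    map sym (expand runs) ++ dollar ∷ []             ∎)

  IsRLE-hatRuns : ∀ {runs} → IsRLE runs → IsRLE (hatRuns runs)
  IsRLE-hatRuns {runs} (pos , lk) = (s≤s z≤n ∷ All.∷ʳ⁺ (All.map⁺ pos) (s≤s z≤n)) , linked runs lk
    where
      sym-injective : ∀ {a b : A} → sym a ≡ sym b → a ≡ b
      sym-injective refl = refl

      Distinct : ∀ {X : Set} → X × ℕ → X × ℕ → Set
      Distinct p q = proj₁ p ≢ proj₁ q

      linked-body : ∀ r rs → Linked Distinct (r ∷ rs) → Linked Distinct (map (map₁ sym) (r ∷ rs) ∷ʳ (dollar , 1))
      linked-body r []        _           = (λ ()) ∷ [-]
      linked-body r (r′ ∷ rs) (r≢r′ ∷ lk) = (r≢r′ ∘ sym-injective) ∷ linked-body r′ rs lk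

      linked : ∀ runs → Linked Distinct runs → Linked Distinct (hatRuns runs)
      linked []       _  = (λ ()) ∷ [-]
      linked (r ∷ rs) lk = (λ ()) ∷ linked-body r rs lk

  kernel-last : ∀ s {K p} → last (flashback _≟A_ s) ≡ just (K , p) → kernel _≟A_ s ≡ just K
  kernel-last s eq rewrite eq = refl

  kernel-centre : ∀ {runs K} → IsRLE runs → Centre (hatRuns runs) K → kernel _≟A_ (expand runs) ≡ just K
  kernel-centre {runs} {K} rle c = kernel-last (expand runs) (begin
    last (flashback _≟A_ (expand runs))
      ≡⟨ cong (λ span → last (flashFuel _≟A_ (length span) span)) (≡-sym (expand-hatRuns runs)) ⟩
    last (flashFuel _≟A_ (length (expand (hatRuns runs))) (expand (hatRuns runs)))
      ≡⟨ flashFuel-centre _ c (IsRLE-hatRuns rle) ≤-refl ⟩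
    just (K , 0) ∎)

mainTheorem11 : {A : Set} (_≟A_ : DecidableEquality A) (s : List A) → s ≢ [] →
    (runs : List (A × ℕ)) → IsRLE runs → expand runs ≡ s →
    ((length runs % 2 ≡ 1 →
        kernel _≟A_ s ≡ just (map sym (block runs ⌈ length runs /2⌉)))
     × (length runs % 2 ≡ 0 →
        kernel _≟A_ s ≡ just (map sym (block runs ⌈ length runs /2⌉ ++ block runs (suc ⌈ length runs /2⌉)))))
    × (∀ K → kernel _≟A_ s ≡ just K → AtMostTwoSymbols K)
mainTheorem11 _≟A_ s s≢[] [] _ refl = ⊥-elim (s≢[] refl)
mainTheorem11 {A} _≟A_ _ _ runs@(r ∷ rs) rle refl = (kernel-odd , kernel-even) , kernel-atMostTwo
  where
    open Flashback _≟A_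

    K : List A
    K = proj₁ (centre-exists (length rs) r rs ≤-refl)

    centre : Centre runs K
    centre = proj₂ (centre-exists (length rs) r rs ≤-refl)

    centreHat : Centre (hatRuns runs) (map sym K)
    centreHat = peel _ _ (Centre-map sym centre)

    kernel≡K : kernel _≟A_ (expand runs) ≡ just (map sym K)
    kernel≡K = kernel-centre rle centreHat

    kernel-odd : length runs % 2 ≡ 1 → kernel _≟A_ (expand runs) ≡ just (map sym (block runs ⌈ length runs /2⌉))
    kernel-odd odd = trans kernel≡K (cong (just ∘ map sym) (centre-odd centre odd))

    kernel-even : length runs % 2 ≡ 0 →
      kernel _≟A_ (expand runs) ≡ just (map sym (block runs ⌈ length runs /2⌉ ++ block runs (suc ⌈ length runs /2⌉)))
    kernel-even even = trans kernel≡K (cong (just ∘ map sym) (centre-even centre even))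

    kernel-atMostTwo : ∀ K′ → kernel _≟A_ (expand runs) ≡ just K′ → AtMostTwoSymbols K′
    kernel-atMostTwo K′ eq =
      subst AtMostTwoSymbols (just-injective (trans (≡-sym kernel≡K) eq)) (Centre-atMostTwoSymbols centreHat)
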